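{- Let $\mathsf{CS}$ be a constant specification. For every formula $A$: if $\mathsf{iJT4}_{\mathsf{CS}}\vdash A$, then $A$ is valid with respect to basic modular models, i.e., for every basic modular model $\mathcal{M}=(W,\leq,*)$ (with respect to $\mathsf{CS}$) and every $w\in W$, $(\mathcal{M},w)\vDash A$.
   Context: Justification terms are built from countably many justification constants and countably many justification variables using the binary operations $\cdot$ and $+$ and the unary operation $!$. Formulas are built from a countable set $\mathsf{Prop}$ of atomic propositions and the constant $\bot$ using $\land, \lor, \rightarrow$, and the clause: if $A$ is a formula and $t$ a term, then $t:A$ is a formula. $\mathsf{Tm}$ denotes the set of terms. The axioms of $\mathsf{iJT4}$ are: all axioms of intuitionistic propositional logic (in this language); $t:(A\rightarrow B)\rightarrow(s:A\rightarrow (t\cdot s):B)$; $t:A\rightarrow (t+s):A$ and $s:A\rightarrow (t+s):A$; $t:A\rightarrow A$; $t:A\rightarrow\, !t:(t:A)$. A constant specification $\mathsf{CS}$ is a set of pairs $(c,A)$ with $c$ a constant and $A$ an axiom of $\mathsf{iJT4}$. $\mathsf{iJT4}_{\mathsf{CS}}$ is the Hilbert system with these axioms and the rules modus ponens (from $A$ and $A\rightarrow B$ infer $B$) and axiom necessitation (if $(c,A)\in\mathsf{CS}$, infer $c:A$). For sets of formulas $X,Y$ and a term $s$ let $X\cdot Y := \{A \mid \exists B\in Y,\ (B\rightarrow A)\in X\}$ and $s:X := \{s:A \mid A\in X\}$. A basic evaluation is a tuple $(W,\leq,*)$ with $W\neq\varnothing$, $\leq$ a partial order on $W$, $*:\mathsf{Prop}\times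 W\to\{0,1\}$ and $*:\mathsf{Tm}\times W\to\mathcal{P}(\text{Formulas})$ (write $t^*_w$ for $*(t,w)$, $p^*_w$ for $*(p,w)$), such that for all $w\in W$, all terms $s,t$ and formulas $A$: (1) $s^*_w\cdot t^*_w\subseteq (s\cdot t)^*_w$; (2) $s^*_w\cup t^*_w\subseteq (s+t)^*_w$; (3) if $(t,A)\in\mathsf{CS}$ then $A\in t^*_w$; (4) $s:s^*_w\subseteq (!s)^*_w$; (M1) if $p^*_w=1$ and $w\leq v$ then $p^*_v=1$; (M2) if $w\leq v$ then $t^*_w\subseteq t^*_v$. Truth: $(\mathcal{M},w)\nvDash\bot$; $(\mathcal{M},w)\vDash p$ iff $p^*_w=1$; $\land,\lor$ are evaluated locally; $(\mathcal{M},w)\vDash A\rightarrow B$ iff for all $v\geq w$ with $(\mathcal{M},v)\vDash A$ we have $(\mathcal{M},v)\vDash B$; $(\mathcal{M},w)\vDash t:A$ iff $A\in t^*_w$. A basic evaluation is factive if $A\in t^*_w$ implies $(\mathcal{M},w)\vDash A$ for all $A,t,w$. A basic modular model is a factive basic evaluation. -}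

module Defs where

open import Data.Nat using (ℕ)
open import Data.Bool using (Bool; true)
open import Data.Product using (_×_)
open import Data.Sum using (_⊎_)
open import Data.Empty using (⊥)
open import Relation.Binary.PropositionalEquality using (_≡_)
open import Relation.Binary.Structures using (IsPartialOrder)
open import Level using (suc; zero)

data Tm : Set where
  con  : ℕ → Tm
  var  : ℕ → Tm
  _·_  : Tm → Tm → Tm
  _⊕_  : Tm → Tm → Tm
  !_   : Tm → Tm

infixr 5 _⇒_
data Fm : Set where
  atom : ℕ → Fm
  ⊥′   : Fm
  _∧′_ : Fm → Fm → Fm
  _∨′_ : Fm → Fm → Fm
  _⇒_  : Fm → Fm → Fm
  _∶_  : Tm → Fm → Fm

data Axiom : Fm → Set where
  ax-K    : ∀ A B → Axiom (A ⇒ (B ⇒ A))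
  ax-S    : ∀ A B C → Axiom ((A ⇒ (B ⇒ C)) ⇒ ((A ⇒ B) ⇒ (A ⇒ C)))
  ax-∧E₁  : ∀ A B → Axiom ((A ∧′ B) ⇒ A)
  ax-∧E₂  : ∀ A B → Axiom ((A ∧′ B) ⇒ B)
  ax-∧I   : ∀ A B → Axiom (A ⇒ (B ⇒ (A ∧′ B)))
  ax-∨I₁  : ∀ A B → Axiom (A ⇒ (A ∨′ B))
  ax-∨I₂  : ∀ A B → Axiom (B ⇒ (A ∨′ B))
  ax-∨E   : ∀ A B C → Axiom ((A ⇒ C) ⇒ ((B ⇒ C) ⇒ ((A ∨′ B) ⇒ C)))
  ax-⊥    : ∀ A → Axiom (⊥′ ⇒ A)
  ax-app  : ∀ t s A B → Axiom ((t ∶ (A ⇒ B)) ⇒ ((s ∶ A) ⇒ ((t · s) ∶ B)))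
  ax-sum₁ : ∀ t s A → Axiom ((t ∶ A) ⇒ ((t ⊕ s) ∶ A))
  ax-sum₂ : ∀ t s A → Axiom ((s ∶ A) ⇒ ((t ⊕ s) ∶ A))
  ax-fact : ∀ t A → Axiom ((t ∶ A) ⇒ A)
  ax-!    : ∀ t A → Axiom ((t ∶ A) ⇒ ((! t) ∶ (t ∶ A)))

record ConstSpec : Set₁ where
  field
    CS    : ℕ → Fm → Set
    CS-ax : ∀ {c A} → CS c A → Axiom A
open ConstSpec public

data _⊢_ (cs : ConstSpec) : Fm → Set where
  axiom : ∀ {A} → Axiom A → cs ⊢ A
  mp    : ∀ {A B} → cs ⊢ A → cs ⊢ (A ⇒ B) → cs ⊢ B
  nec   : ∀ {c A} → CS cs c A → cs ⊢ (con c ∶ A)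

record BasicEvaluation (cs : ConstSpec) : Set₁ where
  field
    W       : Set
    w₀      : W                         -- W ≠ ∅
    _≤_     : W → W → Set
    isPO    : IsPartialOrder _≡_ _≤_
    val     : ℕ → W → Bool
    ev      : Tm → W → Fm → Set         -- A ∈ t*_w  as  ev t w A
    ev-app  : ∀ s t w A B → ev s w (B ⇒ A) → ev t w B → ev (s · t) w A
    ev-sum₁ : ∀ s t w A → ev s w A → ev (s ⊕ t) w A
    ev-sum₂ : ∀ s t w A → ev t w A → ev (s ⊕ t) w A
    ev-cs   : ∀ c w A → CS cs c A → ev (con c) w A
    ev-!    : ∀ s w A → ev s w A → ev (! s) w (s ∶ A)
    mono-p  : ∀ p w v → val p w ≡ true → w ≤ v → val p v ≡ true
    mono-ev : ∀ t w v A → w ≤ v → ev t w A → ev t v A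
open BasicEvaluation public

_,_⊨_ : ∀ {cs} (M : BasicEvaluation cs) → W M → Fm → Set
M , w ⊨ atom p   = val M p w ≡ true
M , w ⊨ ⊥′       = ⊥
M , w ⊨ (A ∧′ B) = (M , w ⊨ A) × (M , w ⊨ B)
M , w ⊨ (A ∨′ B) = (M , w ⊨ A) ⊎ (M , w ⊨ B)
M , w ⊨ (A ⇒ B)  = ∀ v → _≤_ M w v → M , v ⊨ A → M , v ⊨ B
M , w ⊨ (t ∶ A)  = ev M t w A

Factive : ∀ {cs} → BasicEvaluation cs → Set
Factive M = ∀ t A w → ev M t w A → M , w ⊨ A

record BasicModularModel (cs : ConstSpec) : Set₁ where
  field
    eval    : BasicEvaluation cs
    factive : Factive eval
open BasicModularModel public

-- Truth is persistent along ≤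
-- because atoms and the sets t*_w are monotone, and this is what validates the
-- intuitionistic axioms; the application, sum, ! and necessitation clauses of
-- a basic evaluation validate the corresponding justification axioms, and
-- factivity is used only for  t:A → A.
module Submission where

open import Defs
open import Data.Product using (_,_)
open import Data.Sum using (inj₁; inj₂)
open import Relation.Binary.Structures using (IsPartialOrder)
open import Relation.Binary.PropositionalEquality using (refl)

module _ {cs : ConstSpec} (E : BasicEvaluation cs) where
  open IsPartialOrder (isPO E) using (trans; reflexive)

  ≤-refl : ∀ w → _≤_ E w w
  ≤-refl w = reflexive refl

  ⊨-mono : ∀ A {w v} → _≤_ E w v → E , w ⊨ A → E , v ⊨ A
  ⊨-mono (atom p)  w≤v h         = mono-p E p _ _ h w≤v
  ⊨-mono ⊥′        w≤v ()
  ⊨-mono (A ∧′ B)  w≤v (a , b)   = ⊨-mono A w≤v a , ⊨-mono B w≤v b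
  ⊨-mono (A ∨′ B)  w≤v (inj₁ a)  = inj₁ (⊨-mono A w≤v a)
  ⊨-mono (A ∨′ B)  w≤v (inj₂ b)  = inj₂ (⊨-mono B w≤v b)
  ⊨-mono (A ⇒ B)   w≤v h u v≤u   = h u (trans w≤v v≤u)
  ⊨-mono (t ∶ A)   w≤v h         = mono-ev E t _ _ A w≤v h

  axiom-valid : Factive E → ∀ {A} → Axiom A → ∀ w → E , w ⊨ A
  axiom-valid _ (ax-K A B) w v _ a u v≤u _ = ⊨-mono A v≤u a
  axiom-valid _ (ax-S A B C) w v _ f u v≤u g x u≤x a =
    f x (trans v≤u u≤x) a x (≤-refl x) (g x u≤x a)
  axiom-valid _ (ax-∧E₁ A B) w v _ (a , _) = a
  axiom-valid _ (ax-∧E₂ A B) w v _ (_ , b) = b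
  axiom-valid _ (ax-∧I A B) w v _ a u v≤u b = ⊨-mono A v≤u a , b
  axiom-valid _ (ax-∨I₁ A B) w v _ a = inj₁ a
  axiom-valid _ (ax-∨I₂ A B) w v _ b = inj₂ b
  axiom-valid _ (ax-∨E A B C) w v _ f u v≤u g x u≤x (inj₁ a) = f x (trans v≤u u≤x) a
  axiom-valid _ (ax-∨E A B C) w v _ f u v≤u g x u≤x (inj₂ b) = g x u≤x b
  axiom-valid _ (ax-⊥ A) w v _ ()
  axiom-valid _ (ax-app t s A B) w v _ f u v≤u a =
    ev-app E t s u B A (mono-ev E t v u (A ⇒ B) v≤u f) a
  axiom-valid _ (ax-sum₁ t s A) w v _ a = ev-sum₁ E t s v A a
  axiom-valid _ (ax-sum₂ t s A) w v _ a = ev-sum₂ E t s v A a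
  axiom-valid factive (ax-fact t A) w v _ a = factive t A v a
  axiom-valid _ (ax-! t A) w v _ a = ev-! E t v A a

  ⊢-sound : Factive E → ∀ {A} → cs ⊢ A → ∀ w → E , w ⊨ A
  ⊢-sound factive (axiom ax) w = axiom-valid factive ax w
  ⊢-sound factive (mp ⊢A ⊢A⇒B) w =
    ⊢-sound factive ⊢A⇒B w w (≤-refl w) (⊢-sound factive ⊢A w)
  ⊢-sound _ (nec {c} {A} c∶A∈CS) w = ev-cs E c w A c∶A∈CS

mainTheorem2 : (cs : ConstSpec) (A : Fm) → cs ⊢ A →
    (M : BasicModularModel cs) (w : W (eval M)) → eval M , w ⊨ A
mainTheorem2 cs A ⊢A M w = ⊢-sound (eval M) (factive M) ⊢A w
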